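{- Let $\Gamma=(S,R)$ be a finite tree with a perfect matching $\mathcal P$. For each $s\in S$, $Q(\alpha_s^\vee)\equiv a_s\pmod 2$.
   Context: $V$ is the $\mathbb F_2$-vector space with basis $\{\alpha_s\mid s\in S\}$; $B$ is the bilinear form with $B(\alpha_s,\alpha_t)=1$ if $st\in R$ and $0$ otherwise; $Q:V\to\mathbb F_2$ is the quadratic form with $Q(\alpha_s)=1$ for all $s$ and $Q(\alpha+\beta)=Q(\alpha)+Q(\beta)+B(\alpha,\beta)$. For $s\in S$, $A_s$ is the set of $t\in S\setminus\{s\}$ such that the path in $\Gamma$ from $s$ to $t$ is alternating (edges alternately in and not in $\mathcal P$) with first and last edges in $\mathcal P$; $a_s=|A_s|$ and $\alpha_s^\vee=\sum_{t\in A_s}\alpha_t$. -}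

module Defs where

open import Data.Nat using (ℕ; zero; suc; _<ᵇ_; _≤_)
open import Data.Fin using (Fin; toℕ; _≟_)
import Data.Fin as F
open import Data.Bool using (Bool; true; false; _∧_; _xor_; not; if_then_else_)
open import Data.List using (List; []; _∷_; _++_; [_]; length)
open import Data.List.Relation.Unary.Linked using (Linked)
open import Data.List.Relation.Unary.Unique.Propositional using (Unique)
open import Data.Product using (Σ; ∃; _×_)
open import Data.Sum using (_⊎_)
open import Data.Empty using (⊥)
open import Relation.Nullary using (¬_)
open import Relation.Nullary.Decidable using (⌊_⌋)
open import Relation.Binary.PropositionalEquality using (_≡_; _≢_)
open import Function.Bundles using (_⇔_)

-- Vertex set S = Fin n.  Edge set R and matching P are given as
-- Bool-valued relations (R(s,t) = true iff {s,t} is an edge).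
Rel₂ : ℕ → Set
Rel₂ n = Fin n → Fin n → Bool

record SimpleGraph {n : ℕ} (E : Rel₂ n) : Set where
  field
    sym   : ∀ u v → E u v ≡ E v u
    irrefl : ∀ u → E u u ≡ false

Adj : ∀ {n} → Rel₂ n → Fin n → Fin n → Set
Adj E u v = E u v ≡ true

Connected : ∀ {n} → Rel₂ n → Set
Connected {n} E = ∀ (u v : Fin n) → u ≡ v ⊎ Σ (List (Fin n)) (λ ys → Linked (Adj E) ((u ∷ ys) ++ [ v ]))

IsCycle : ∀ {n} → Rel₂ n → Fin n → List (Fin n) → Set
IsCycle E v ys = 2 ≤ length ys × Unique (v ∷ ys) × Linked (Adj E) ((v ∷ ys) ++ [ v ])

Acyclic : ∀ {n} → Rel₂ n → Set
Acyclic {n} E = ∀ (v : Fin n) (ys : List (Fin n)) → ¬ IsCycle E v ys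

record IsTree {n : ℕ} (E : Rel₂ n) : Set where
  field
    simple    : SimpleGraph E
    connected : Connected E
    acyclic   : Acyclic E

record IsPerfectMatching {n : ℕ} (E P : Rel₂ n) : Set where
  field
    sym     : ∀ u v → P u v ≡ P v u
    sub     : ∀ u v → P u v ≡ true → E u v ≡ true
    perfect : ∀ u → Σ (Fin n) (λ w → P u w ≡ true × (∀ w' → P u w' ≡ true → w' ≡ w))

-- A vertex list v0 v1 ... vk whose edges alternate: in P, not in P, in P, ...
-- with first and last edge in P (so k is odd).
AltP : ∀ {n} → Rel₂ n → List (Fin n) → Set
AltP P (a ∷ b ∷ []) = P a b ≡ true
AltP P (a ∷ b ∷ c ∷ rest) = P a b ≡ true × P b c ≡ false × AltP P (c ∷ rest)
AltP P _ = ⊥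

InA : ∀ {n} → Rel₂ n → Rel₂ n → Fin n → Fin n → Set
InA {n} E P s t = t ≢ s × Σ (List (Fin n)) (λ ys →
  let path = (s ∷ ys) ++ [ t ] in
  Unique path × Linked (Adj E) path × AltP P path)

-- F₂ = Bool with xor as addition and ∧ as multiplication
-- V = F₂^S represented as functions Fin n → Bool (coordinates in basis α)
V : ℕ → Set
V n = Fin n → Bool

⨁ : ∀ {n} → (Fin n → Bool) → Bool
⨁ {zero} f = false
⨁ {suc n} f = f F.zero xor ⨁ (λ i → f (F.suc i))

α : ∀ {n} → Fin n → V n
α s t = ⌊ s ≟ t ⌋

-- bilinear form B(α_s, α_t) = [st ∈ R], extended bilinearly
B : ∀ {n} → Rel₂ n → V n → V n → Bool
B E u w = ⨁ (λ i → ⨁ (λ j → u i ∧ w j ∧ E i j))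

-- the quadratic form with Q(α_s) = 1 and Q(x+y) = Q(x)+Q(y)+B(x,y):
-- Q(Σ c_s α_s) = Σ c_s + Σ_{s<t} c_s c_t B(α_s,α_t)
Q : ∀ {n} → Rel₂ n → V n → Bool
Q E v = ⨁ v xor ⨁ (λ i → ⨁ (λ j → v i ∧ v j ∧ (toℕ i <ᵇ toℕ j) ∧ B E (α i) (α j)))

-- α^∨ for a subset A ⊆ S (given by its indicator): Σ_{t∈A} α_t
coroot : ∀ {n} → (Fin n → Bool) → V n
coroot A u = ⨁ (λ t → A t ∧ α t u)

card : ∀ {n} → (Fin n → Bool) → ℕ
card {zero} A = 0
card {suc n} A = (if A F.zero then 1 else 0) Data.Nat.+ card (λ i → A (F.suc i))

mod2 : ℕ → Bool
mod2 zero = false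
mod2 (suc k) = not (mod2 k)

-- If two elements t, t' of A_s were adjacent, uniqueness of paths in the tree
-- would make the path from s to one of them the path to the other extended by the
-- edge tt'.  Both paths alternate with first and last edge in 𝒫, so both have an
-- odd number of edges, which is impossible for lengths differing by one.  Hence
-- A_s is an independent set, B vanishes on pairs of its elements, and Q(α_s^∨) is
-- the sum of the Q(α_t) = 1 over t ∈ A_s.
module Submission where

open import Defs
open import Data.Nat using (ℕ; zero; suc; _≤_; _<ᵇ_; s≤s; z≤n)
open import Data.Fin using (Fin; _≟_; toℕ)
import Data.Fin as F
open import Data.Fin.Properties using (suc-injective)
open import Data.Bool using (Bool; true; false; _∧_; _xor_; not)
open import Data.Bool.Properties using (not-involutive; xor-identityʳ; ∧-zeroʳ; ∧-identityʳ)
open import Data.List using (List; []; _∷_; _++_; [_]; length; reverse; head)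
open import Data.List.Properties
  using (++-assoc; length-++-sucʳ; length-++-comm; length-reverse; reverse-++; unfold-reverse)
open import Data.List.Relation.Unary.Linked as Linked using (Linked; []; [-]; _∷_)
open import Data.List.Relation.Unary.Unique.Propositional using (Unique)
import Data.List.Relation.Unary.Unique.Propositional.Properties as Uniqueₚ
open import Data.List.Relation.Unary.AllPairs using ([]; _∷_)
open import Data.List.Relation.Unary.All as All using (All; []; _∷_)
open import Data.List.Relation.Unary.All.Properties as Allₚ using (¬Any⇒All¬; All¬⇒¬Any)
open import Data.List.Relation.Unary.Any using (Any; here; there)
open import Data.List.Relation.Binary.Disjoint.Propositional using (Disjoint)
open import Data.List.Membership.Propositional using (_∈_; _∉_; lose)
open import Data.List.Membership.Propositional.Properties using (∈-++⁺ˡ; ∈-++⁺ʳ; ∈-++⁻; ∈-∃++)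
open import Data.List.Relation.Unary.Any.Properties using (reverse⁻)
import Data.List.Membership.DecPropositional as DecMembership
open import Data.Maybe.Properties using (just-injective)
open import Data.Product using (∃; ∃₂; _×_; _,_; proj₁; proj₂)
open import Data.Sum using (_⊎_; inj₁; inj₂)
open import Data.Empty using (⊥; ⊥-elim)
open import Relation.Nullary using (¬_; yes; no)
open import Relation.Binary.Definitions using (Symmetric; DecidableEquality)
open import Relation.Binary.PropositionalEquality
  using (_≡_; _≢_; refl; sym; trans; cong; cong₂; subst; module ≡-Reasoning)
open import Function.Bundles using (_⇔_; Equivalence)
open import Function using (_∘_)
open ≡-Reasoning

module _ {A : Set} where

  Unique-++⁻ˡ : ∀ xs {ys} → Unique (xs ++ ys) → Unique {A = A} xs
  Unique-++⁻ˡ []       _        = []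
  Unique-++⁻ˡ (x ∷ xs) (x∉ ∷ u) = Allₚ.++⁻ˡ xs x∉ ∷ Unique-++⁻ˡ xs u

  Unique-++⁻ʳ : ∀ xs {ys} → Unique (xs ++ ys) → Unique {A = A} ys
  Unique-++⁻ʳ []       u       = u
  Unique-++⁻ʳ (x ∷ xs) (_ ∷ u) = Unique-++⁻ʳ xs u

  Unique-glue : ∀ xs {w ys} → Unique (xs ++ [ w ]) → Unique (w ∷ ys) → Disjoint xs ys →
                Unique {A = A} (xs ++ w ∷ ys)
  Unique-glue []       _          u d = u
  Unique-glue (x ∷ xs) (x∉ ∷ uxs) u d =
    Allₚ.++⁺ (Allₚ.++⁻ˡ xs x∉)
             (All.head (Allₚ.++⁻ʳ xs x∉) ∷ ¬Any⇒All¬ _ (λ x∈ → d (here refl , x∈)))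
    ∷ Unique-glue xs uxs u (λ (z∈xs , z∈ys) → d (there z∈xs , z∈ys))

  Unique-snoc : ∀ xs {w} → Unique xs → w ∉ xs → Unique {A = A} (xs ++ [ w ])
  Unique-snoc xs u w∉ = Uniqueₚ.++⁺ u ([] ∷ []) λ { (w∈ , here refl) → w∉ w∈ }

  Unique-reverse : ∀ xs → Unique xs → Unique {A = A} (reverse xs)
  Unique-reverse []       _        = []
  Unique-reverse (x ∷ xs) (x∉ ∷ u) rewrite unfold-reverse x xs =
    Unique-snoc (reverse xs) (Unique-reverse xs u) (All¬⇒¬Any x∉ ∘ reverse⁻)

module _ {A : Set} (_≟ᴬ_ : DecidableEquality A) where
  open DecMembership _≟ᴬ_ using (_∈?_)

  first-member : ∀ xs {ys} → Any (_∈ ys) xs →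
    ∃₂ λ X₁ X₂ → ∃ λ w → xs ≡ X₁ ++ w ∷ X₂ × All (_∉ ys) X₁ × w ∈ ys
  first-member (x ∷ xs) {ys} meet with x ∈? ys | meet
  ... | yes x∈ | _          = [] , xs , x , refl , [] , x∈
  ... | no x∉  | here x∈    = ⊥-elim (x∉ x∈)
  ... | no x∉  | there meet' with first-member xs meet'
  ...   | X₁ , X₂ , w , refl , X₁∉ , w∈ = x ∷ X₁ , X₂ , w , refl , x∉ ∷ X₁∉ , w∈

module _ {A : Set} {R : A → A → Set} where

  Linked-++⁻ˡ : ∀ xs {ys} → Linked R (xs ++ ys) → Linked R xs
  Linked-++⁻ˡ []           _       = []
  Linked-++⁻ˡ (x ∷ [])     _       = [-]
  Linked-++⁻ˡ (x ∷ y ∷ xs) (r ∷ l) = r ∷ Linked-++⁻ˡ (y ∷ xs) l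

  Linked-++⁻ʳ : ∀ xs {ys} → Linked R (xs ++ ys) → Linked R ys
  Linked-++⁻ʳ []       l = l
  Linked-++⁻ʳ (x ∷ xs) l = Linked-++⁻ʳ xs (Linked.tail l)

  Linked-glue : ∀ xs {w ys} → Linked R (xs ++ [ w ]) → Linked R (w ∷ ys) → Linked R (xs ++ w ∷ ys)
  Linked-glue []           _         l = l
  Linked-glue (x ∷ [])     (r ∷ [-]) l = r ∷ l
  Linked-glue (x ∷ y ∷ xs) (r ∷ l′)  l = r ∷ Linked-glue (y ∷ xs) l′ l

  Linked-snoc : ∀ xs {w z} → Linked R (xs ++ [ w ]) → R w z → Linked R (xs ++ w ∷ [ z ])
  Linked-snoc xs l r = Linked-glue xs l (r ∷ [-])

  Linked-reverse : Symmetric R → ∀ xs → Linked R xs → Linked R (reverse xs)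
  Linked-reverse R-sym []           _       = []
  Linked-reverse R-sym (x ∷ [])     _       = [-]
  Linked-reverse R-sym (x ∷ y ∷ xs) (r ∷ l)
    rewrite unfold-reverse x (y ∷ xs) | unfold-reverse y xs
          | ++-assoc (reverse xs) [ y ] [ x ] =
    Linked-snoc (reverse xs)
      (subst (Linked R) (unfold-reverse y xs) (Linked-reverse R-sym (y ∷ xs) l)) (R-sym r)

module _ {n : ℕ} (E : Rel₂ n) where

  SimpleWalk : List (Fin n) → Set
  SimpleWalk zs = Unique zs × Linked (Adj E) zs

  IsPath : Fin n → List (Fin n) → Fin n → Set
  IsPath u xs v = SimpleWalk (u ∷ xs ++ [ v ])

module _ {n : ℕ} {E : Rel₂ n} where

  SimpleWalk-++⁻ˡ : ∀ xs {ys} → SimpleWalk E (xs ++ ys) → SimpleWalk E xs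
  SimpleWalk-++⁻ˡ xs (u , l) = Unique-++⁻ˡ xs u , Linked-++⁻ˡ xs l

  SimpleWalk-++⁻ʳ : ∀ xs {ys} → SimpleWalk E (xs ++ ys) → SimpleWalk E ys
  SimpleWalk-++⁻ʳ xs (u , l) = Unique-++⁻ʳ xs u , Linked-++⁻ʳ xs l

  SimpleWalk-prefix : ∀ xs {w ys} → SimpleWalk E (xs ++ w ∷ ys) → SimpleWalk E (xs ++ [ w ])
  SimpleWalk-prefix xs {w} {ys} p =
    SimpleWalk-++⁻ˡ (xs ++ [ w ]) (subst (SimpleWalk E) (sym (++-assoc xs [ w ] ys)) p)

  IsPath-snoc : ∀ {u xs v w} → IsPath E u xs v → Adj E v w → w ∉ u ∷ xs ++ [ v ] →
                IsPath E u (xs ++ [ v ]) w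
  IsPath-snoc {u} {xs} {v} (uq , l) e w∉ =
    Unique-snoc (u ∷ xs ++ [ v ]) uq w∉ ,
    subst (λ zs → Linked (Adj E) (u ∷ zs)) (sym (++-assoc xs [ v ] [ _ ])) (Linked-snoc (u ∷ xs) l e)

  IsPath-reverse : (∀ a b → E a b ≡ E b a) → ∀ {u xs v} → IsPath E u xs v → IsPath E v (reverse xs) u
  IsPath-reverse E-sym {u} {xs} {v} (uq , l) =
    subst (SimpleWalk E) reverse-path
      (Unique-reverse (u ∷ xs ++ [ v ]) uq ,
       Linked-reverse (λ {a} {b} e → trans (E-sym b a) e) (u ∷ xs ++ [ v ]) l)
    where
    reverse-path : reverse (u ∷ xs ++ [ v ]) ≡ v ∷ reverse xs ++ [ u ]
    reverse-path = begin
      reverse (u ∷ xs ++ [ v ])      ≡⟨ unfold-reverse u (xs ++ [ v ]) ⟩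
      reverse (xs ++ [ v ]) ++ [ u ] ≡⟨ cong (_++ [ u ]) (reverse-++ xs [ v ]) ⟩
      v ∷ reverse xs ++ [ u ]        ∎

  IsPath-split : ∀ {u} X₁ {w X₂ v} → IsPath E u (X₁ ++ w ∷ X₂) v →
                 IsPath E u X₁ w × IsPath E w X₂ v
  IsPath-split {u} X₁ {w} {X₂} {v} p =
    SimpleWalk-prefix (u ∷ X₁) p′ , SimpleWalk-++⁻ʳ (u ∷ X₁) p′
    where
    p′ : SimpleWalk E (u ∷ X₁ ++ w ∷ X₂ ++ [ v ])
    p′ = subst (λ zs → SimpleWalk E (u ∷ zs)) (++-assoc X₁ (w ∷ X₂) [ v ]) p

module UniquePaths {n : ℕ} {E : Rel₂ n} (E-sym : ∀ a b → E a b ≡ E b a) (acyclic : Acyclic E) where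

  -- Out along X, back along Y reversed: a cycle at u, up to its length condition.
  closedWalk : ∀ {u X Y w} → IsPath E u X w → IsPath E u Y w → Disjoint X Y →
    Unique (u ∷ X ++ w ∷ reverse Y) × Linked (Adj E) ((u ∷ X ++ w ∷ reverse Y) ++ [ u ])
  closedWalk {u} {X} {Y} {w} (up , lp) q@(u∉Y ∷ _ , _) X#Y =
    Unique-glue (u ∷ X) up (Unique-++⁻ˡ (w ∷ reverse Y) (proj₁ q⁻¹)) u∷X#Y⁻¹ ,
    subst (λ zs → Linked (Adj E) (u ∷ zs)) (sym (++-assoc X (w ∷ reverse Y) [ u ]))
      (Linked-glue (u ∷ X) lp (proj₂ q⁻¹))
    where
    q⁻¹ : IsPath E w (reverse Y) u
    q⁻¹ = IsPath-reverse E-sym q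
    u∷X#Y⁻¹ : Disjoint (u ∷ X) (reverse Y)
    u∷X#Y⁻¹ (here refl , u∈) = All¬⇒¬Any u∉Y (∈-++⁺ˡ (reverse⁻ {xs = Y} u∈))
    u∷X#Y⁻¹ (there x∈ , x∈′) = X#Y (x∈ , reverse⁻ {xs = Y} x∈′)

  disjoint-paths-equal : ∀ {u X Y w} → IsPath E u X w → IsPath E u Y w → Disjoint X Y → X ≡ Y
  disjoint-paths-equal {X = []} {[]} p q X#Y = refl
  disjoint-paths-equal {u} {[]} {y ∷ Y} {w} p q X#Y = ⊥-elim (acyclic u _ (length≥2 , closedWalk p q X#Y))
    where
    length≥2 : 2 ≤ length (w ∷ reverse (y ∷ Y))
    length≥2 = s≤s (subst (1 ≤_) (sym (length-reverse (y ∷ Y))) (s≤s z≤n))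
  disjoint-paths-equal {u} {x ∷ X} {Y} {w} p q X#Y = ⊥-elim (acyclic u _ (length≥2 , closedWalk p q X#Y))
    where
    length≥2 : 2 ≤ length (x ∷ X ++ w ∷ reverse Y)
    length≥2 = s≤s (subst (1 ≤_) (sym (length-++-sucʳ X w (reverse Y))) (s≤s z≤n))

  -- Cut both walks at the first vertex of xs lying on ys: the two prefixes are
  -- internally disjoint paths, hence equal, hence empty.
  first-steps-agree : ∀ {u} xs ys → SimpleWalk E (u ∷ xs) → SimpleWalk E (u ∷ ys) →
                      Any (_∈ ys) xs → head xs ≡ head ys
  first-steps-agree {u} xs ys p q meet
    with X₁ , X₂ , w , refl , X₁∉ys , w∈ys ← first-member _≟_ xs meet
    with Y₁ , Y₂ , refl ← ∈-∃++ w∈ys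
    with disjoint-paths-equal (SimpleWalk-prefix (u ∷ X₁) p) (SimpleWalk-prefix (u ∷ Y₁) q)
           (λ (z∈X₁ , z∈Y₁) → All.lookup X₁∉ys z∈X₁ (∈-++⁺ˡ z∈Y₁))
  ... | refl with X₁ | X₁∉ys
  ...   | []      | _        = refl
  ...   | x ∷ X₁′ | x∉ys ∷ _ = ⊥-elim (x∉ys (∈-++⁺ˡ {xs = x ∷ X₁′} (here refl)))

  no-shortcut : ∀ {u y ys v} → IsPath E u [] v → IsPath E u (y ∷ ys) v → ⊥
  no-shortcut {u} {y} {ys} {v} p q@(_ ∷ y∉ ∷ _ , _)
    with refl ← just-injective (first-steps-agree [ v ] (y ∷ ys ++ [ v ]) p q
                                  (here (there (∈-++⁺ʳ ys (here refl)))))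
    = All¬⇒¬Any y∉ (∈-++⁺ʳ ys (here refl))

  path-unique : ∀ {u xs ys v} → IsPath E u xs v → IsPath E u ys v → xs ≡ ys
  path-unique {xs = []}     {[]}     p q = refl
  path-unique {xs = []}     {y ∷ ys} p q = ⊥-elim (no-shortcut p q)
  path-unique {xs = x ∷ xs} {[]}     p q = ⊥-elim (no-shortcut q p)
  path-unique {xs = x ∷ xs} {y ∷ ys} {v} p q
    with refl ← just-injective (first-steps-agree (x ∷ xs ++ [ v ]) (y ∷ ys ++ [ v ]) p q
                                  (lose (∈-++⁺ʳ (x ∷ xs) (here refl)) (∈-++⁺ʳ (y ∷ ys) (here refl))))
    = cong (x ∷_) (path-unique (SimpleWalk-++⁻ʳ [ _ ] p) (SimpleWalk-++⁻ʳ [ _ ] q))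

module _ {n : ℕ} {E : Rel₂ n} (tree : IsTree E) where
  open IsTree tree
  open SimpleGraph simple renaming (sym to E-sym)
  open UniquePaths E-sym acyclic
  open DecMembership (_≟_ {n = n}) using (_∈?_)

  adjacent⇒distinct : ∀ {i j} → Adj E i j → i ≢ j
  adjacent⇒distinct {i} i~j refl with () ← trans (sym i~j) (irrefl i)

  edge-path : ∀ {i j} → Adj E i j → IsPath E i [] j
  edge-path i~j = (adjacent⇒distinct i~j ∷ []) ∷ [] ∷ [] , i~j ∷ [-]

  paths-to-adjacent : ∀ {s xs i ys j} → IsPath E s xs i → IsPath E s ys j → Adj E i j →
                   ys ≡ xs ++ [ i ] ⊎ xs ≡ ys ++ [ j ]
  paths-to-adjacent {s} {xs} {i} {ys} {j} p q@(s∉ ∷ _ , _) i~j with j ∈? xs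
  ... | yes j∈xs
    with X₁ , X₂ , refl ← ∈-∃++ j∈xs
    with refl ← path-unique (proj₁ (IsPath-split X₁ p)) q
    with refl ← path-unique {ys = []} (proj₂ (IsPath-split X₁ p)) (edge-path (trans (E-sym j i) i~j))
    = inj₂ refl
  ... | no j∉xs = inj₁ (path-unique q (IsPath-snoc p i~j j∉path))
    where
    j∉path : j ∉ s ∷ xs ++ [ i ]
    j∉path (here refl) = All¬⇒¬Any s∉ (∈-++⁺ʳ ys (here refl))
    j∉path (there j∈) with ∈-++⁻ xs j∈
    ... | inj₁ j∈xs       = j∉xs j∈xs
    ... | inj₂ (here j≡i) = adjacent⇒distinct i~j (sym j≡i)

module _ {n : ℕ} (P : Rel₂ n) where

  AltP-even : ∀ L → AltP P L → mod2 (length L) ≡ false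
  AltP-even (a ∷ b ∷ [])       _           = refl
  AltP-even (a ∷ b ∷ c ∷ rest) (_ , _ , h) = trans (not-involutive _) (AltP-even (c ∷ rest) h)

  AltP-snoc : ∀ L {x} → AltP P L → ¬ AltP P (L ++ [ x ])
  AltP-snoc L {x} h h′ with () ← begin
    true                      ≡⟨ cong not (AltP-even L h) ⟨
    mod2 (length ([ x ] ++ L)) ≡⟨ cong mod2 (length-++-comm [ x ] L) ⟩
    mod2 (length (L ++ [ x ])) ≡⟨ AltP-even (L ++ [ x ]) h′ ⟩
    false                     ∎

InA-independent : ∀ {n} {E P : Rel₂ n} → IsTree E →
                  ∀ {s i j} → InA E P s i → InA E P s j → ¬ Adj E i j
InA-independent {P = P} tree {s} (_ , xs , p₁ , p₂ , alt) (_ , ys , q₁ , q₂ , alt′) i~j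
  with paths-to-adjacent tree (p₁ , p₂) (q₁ , q₂) i~j
... | inj₁ refl = AltP-snoc P (s ∷ xs ++ [ _ ]) alt alt′
... | inj₂ refl = AltP-snoc P (s ∷ ys ++ [ _ ]) alt′ alt

⨁-cong : ∀ {n} {f g : Fin n → Bool} → (∀ i → f i ≡ g i) → ⨁ f ≡ ⨁ g
⨁-cong {zero}  _ = refl
⨁-cong {suc n} h = cong₂ _xor_ (h F.zero) (⨁-cong (h ∘ F.suc))

⨁-zero : ∀ {n} {f : Fin n → Bool} → (∀ i → f i ≡ false) → ⨁ f ≡ false
⨁-zero {zero}      _ = refl
⨁-zero {suc n} {f} h rewrite h F.zero = ⨁-zero (h ∘ F.suc)

⨁-single : ∀ {n} (f : Fin n → Bool) u → (∀ t → t ≢ u → f t ≡ false) → ⨁ f ≡ f u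
⨁-single {suc n} f F.zero h =
  trans (cong (f F.zero xor_) (⨁-zero (λ i → h (F.suc i) λ ()))) (xor-identityʳ _)
⨁-single {suc n} f (F.suc u) h rewrite h F.zero (λ ()) =
  ⨁-single (f ∘ F.suc) u (λ t t≢u → h (F.suc t) (t≢u ∘ suc-injective))

⨁≡mod2-card : ∀ {n} (A : Fin n → Bool) → ⨁ A ≡ mod2 (card A)
⨁≡mod2-card {zero}  A = refl
⨁≡mod2-card {suc n} A with A F.zero
... | true  = cong not (⨁≡mod2-card (A ∘ F.suc))
... | false = ⨁≡mod2-card (A ∘ F.suc)

α-diag : ∀ {n} (i : Fin n) → α i i ≡ true
α-diag i with i ≟ i
... | yes _  = refl
... | no i≢i = ⊥-elim (i≢i refl)

α-off-diag : ∀ {n} {i j : Fin n} → i ≢ j → α i j ≡ false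
α-off-diag {i = i} {j} i≢j with i ≟ j
... | yes i≡j = ⊥-elim (i≢j i≡j)
... | no _    = refl

coroot-apply : ∀ {n} (A : Fin n → Bool) u → coroot A u ≡ A u
coroot-apply A u = begin
  ⨁ (λ t → A t ∧ α t u)
    ≡⟨ ⨁-single _ u (λ t t≢u → trans (cong (A t ∧_) (α-off-diag t≢u)) (∧-zeroʳ (A t))) ⟩
  A u ∧ α u u           ≡⟨ cong (A u ∧_) (α-diag u) ⟩
  A u ∧ true            ≡⟨ ∧-identityʳ (A u) ⟩
  A u                   ∎

B-α : ∀ {n} (E : Rel₂ n) i j → B E (α i) (α j) ≡ E i j
B-α E i j = begin
  ⨁ (λ a → ⨁ (λ b → α i a ∧ α j b ∧ E a b))
    ≡⟨ ⨁-single _ i (λ a a≢i → ⨁-zero λ b → cong (_∧ (α j b ∧ E a b)) (α-off-diag (a≢i ∘ sym))) ⟩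
  ⨁ (λ b → α i i ∧ α j b ∧ E i b)
    ≡⟨ ⨁-cong (λ b → cong (_∧ (α j b ∧ E i b)) (α-diag i)) ⟩
  ⨁ (λ b → α j b ∧ E i b)
    ≡⟨ ⨁-single _ j (λ b b≢j → cong (_∧ E i b) (α-off-diag (b≢j ∘ sym))) ⟩
  α j j ∧ E i j                             ≡⟨ cong (_∧ E i j) (α-diag j) ⟩
  E i j                                     ∎

Independent : ∀ {n} → Rel₂ n → (Fin n → Bool) → Set
Independent E A = ∀ {i j} → A i ≡ true → A j ≡ true → ¬ Adj E i j

Q-coroot-independent : ∀ {n} (E : Rel₂ n) (A : Fin n → Bool) → Independent E A →
                       Q E (coroot A) ≡ mod2 (card A)
Q-coroot-independent E A independent = begin
  Q E (coroot A)
    ≡⟨ cong₂ _xor_ (⨁-cong (coroot-apply A)) (⨁-zero λ i → ⨁-zero λ j → cross-term i j) ⟩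
  ⨁ A xor false    ≡⟨ xor-identityʳ _ ⟩
  ⨁ A              ≡⟨ ⨁≡mod2-card A ⟩
  mod2 (card A)    ∎
  where
  cross-term : ∀ i j → coroot A i ∧ coroot A j ∧ (toℕ i <ᵇ toℕ j) ∧ B E (α i) (α j) ≡ false
  cross-term i j rewrite coroot-apply A i | coroot-apply A j | B-α E i j
    with A i in Ai | A j in Aj | E i j in i~j
  ... | false | _     | _     = refl
  ... | true  | false | _     = refl
  ... | true  | true  | false = ∧-zeroʳ _
  ... | true  | true  | true  = ⊥-elim (independent Ai Aj i~j)

lemma4p4 : (n : ℕ) (E P : Fin n → Fin n → Bool) → IsTree E → IsPerfectMatching E P →
    (s : Fin n) (A : Fin n → Bool) → (∀ t → (A t ≡ true) ⇔ InA E P s t) →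
    Q E (coroot A) ≡ mod2 (card A)
lemma4p4 _ E P tree _ _ A A⇔InA = Q-coroot-independent E A λ {i} {j} Ai Aj →
  InA-independent tree (Equivalence.to (A⇔InA i) Ai) (Equivalence.to (A⇔InA j) Aj)
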